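{- Let $r\ge 2$ and $k\ge 3$ be integers. Let $\mathcal{H}$ be a $K_3^{(2)}$-free multicolored cluster graph whose underlying graph is $K_k$ and whose edge lists are subsets of $[r]$ of size at least two. Then $$\prod_{e\in E(\mathcal{H})}|L_e|\le \tilde{c}_k(r)=\left(\frac{r}{\binom{k}{2}}\left\lfloor\frac k2\right\rfloor\right)^{\binom k2}.$$
   Context: A multicolored cluster graph is a finite simple graph in which each edge $e$ is assigned a nonempty list $L_e\subseteq[r]$. It is $K_3^{(2)}$-free if there is no triangle together with a choice of one color from each of its three edge lists such that exactly two distinct colors are chosen (for lists of size at least 2, equivalently: the lists on the edges of every triangle are pairwise disjoint). -}

module Defs where

open import Data.Nat using (ℕ; _*_)
open import Data.Fin using (Fin; _<_; _<?_)
open import Data.Fin.Subset using (Subset; _∈_; ∣_∣)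
open import Data.List using (List; filter; cartesianProduct; allFin; map)
open import Data.Nat.ListAction using (product)
open import Data.Product using (_×_; _,_; proj₁; proj₂)
open import Data.Sum using (_⊎_)
open import Relation.Binary.PropositionalEquality using (_≡_; _≢_)
open import Relation.Nullary using (¬_)

-- A multicolored cluster graph with underlying graph K_k on vertex set Fin k,
-- colors in [r] = Fin r.  The list of the edge {i,j} with i < j is  L i j
-- (entries L i j with ¬ i < j are ignored).
ColoredKk : ℕ → ℕ → Set
ColoredKk k r = Fin k → Fin k → Subset r

edgesK : (k : ℕ) → List (Fin k × Fin k)
edgesK k = filter (λ p → proj₁ p <? proj₂ p) (cartesianProduct (allFin k) (allFin k))

edgeProduct : ∀ {k r} → ColoredKk k r → ℕ
edgeProduct {k} L = product (map (λ p → ∣ L (proj₁ p) (proj₂ p) ∣) (edgesK k))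

ExactlyTwo : ∀ {r} → Fin r → Fin r → Fin r → Set
ExactlyTwo a b c = (a ≡ b × b ≢ c) ⊎ (b ≡ c × c ≢ a) ⊎ (a ≡ c × a ≢ b)

K32Free : ∀ {k r} → ColoredKk k r → Set
K32Free {k} {r} L =
  (i j l : Fin k) → i < j → j < l →
  (a b c : Fin r) → a ∈ L i j → b ∈ L j l → c ∈ L i l →
  ¬ ExactlyTwo a b c

-- Each colour c is on the lists of a matching: if two edges at a common vertex both
-- contained c, the third edge of their triangle carries some colour d ≠ c (its list has
-- at least two colours), and the triangle would see exactly the two colours c and d.
-- Double counting pairs (edge, colour) therefore gives ∑ₑ |Lₑ| ≤ r ⌊k/2⌋, and AM-GM
-- over the (k choose 2) edges turns this sum bound into the bound on the product.
module Submission where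

open import Defs
open import Data.Bool using (true; false; if_then_else_)
open import Data.Empty using (⊥)
open import Data.Fin using (Fin; zero; suc; _<_; _<?_; _≟_)
import Data.Fin.Properties as Finₚ
open import Data.Fin.Subset using (Subset; _∈_; _⊆_; ⁅_⁆; inside; outside; ∣_∣)
open import Data.Fin.Subset.Properties using (_∈?_; x∈⁅x⁆; ∣⁅x⁆∣≡1; p⊆q⇒∣p∣≤∣q∣)
open import Data.List using (List; []; _∷_; _++_; length; map; filter; cartesianProduct; allFin; tabulate)
open import Data.List.Properties using (map-++; map-∘; map-cong; map-tabulate; length-map)
open import Data.Nat using (ℕ; zero; suc; NonZero; _+_; _*_; _^_; _≤_; z≤n)
open import Data.Nat.Combinatorics using (_C_; nC1≡n; nCk+nC[k+1]≡[n+1]C[k+1])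
open import Data.Nat.DivMod using (_/_; m*n/n≡m; /-monoˡ-≤)
open import Data.Nat.ListAction using (sum; product)
open import Data.Nat.ListAction.Properties using (sum-++)
open import Data.Nat.Properties
  using ( ≤-refl; ≤-reflexive; ≤-total; <⇒≱; n≤1⇒n≡0∨n≡1; m≤m+n; m≤n⇒∃[o]m+o≡n
        ; +-comm; +-identityʳ; +-mono-≤; +-cancelʳ-≤; *-comm; *-assoc; *-zeroʳ; *-identityʳ
        ; *-monoʳ-≤; *-cancelˡ-≤; ^-monoˡ-≤; m^n≢0; +-0-commutativeMonoid; module ≤-Reasoning)
open import Data.Nat.Tactic.RingSolver using (solve-∀)
open import Data.Product using (∃-syntax; _×_; _,_; proj₁; proj₂)
open import Data.Sum using (_⊎_; inj₁; inj₂)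
open import Data.Vec using ([]; _∷_)
open import Function using (_∘_)
open import Relation.Binary.Definitions using (tri<; tri≈; tri>)
open import Relation.Binary.PropositionalEquality
  using (_≡_; _≢_; refl; sym; trans; cong; cong₂; subst; subst₂; module ≡-Reasoning)
open import Relation.Nullary using (¬_; does; yes; no; ¬?; _×-dec_; contradiction)
open import Relation.Nullary.Decidable using (dec-true; dec-false; decidable-stable)
open import Relation.Unary using (Decidable)
open import Algebra.Properties.CommutativeMonoid.Sum +-0-commutativeMonoid
  using (sum-syntax; ∑-comm; ∑-distrib-+; sum-cong-≗; sum-replicate-zero) renaming (sum to ∑)

^-distribʳ-* : ∀ m n o → (m * n) ^ o ≡ m ^ o * n ^ o
^-distribʳ-* m n zero = refl
^-distribʳ-* m n (suc o) = begin
  m * n * (m * n) ^ o      ≡⟨ cong (m * n *_) (^-distribʳ-* m n o) ⟩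
  m * n * (m ^ o * n ^ o)  ≡⟨ interchange m n (m ^ o) (n ^ o) ⟩
  m * m ^ o * (n * n ^ o)  ∎
  where
  open ≡-Reasoning
  interchange : ∀ a b c d → a * b * (c * d) ≡ a * c * (b * d)
  interchange = solve-∀

*-rearrange-≤ : ∀ {a b c d} → a ≤ b → c ≤ d → a * d + b * c ≤ a * c + b * d
*-rearrange-≤ {a} {c = c} a≤b c≤d with m≤n⇒∃[o]m+o≡n a≤b | m≤n⇒∃[o]m+o≡n c≤d
... | p , refl | q , refl =
  subst (a * (c + q) + (a + p) * c ≤_) (gap a p c q) (m≤m+n _ (p * q))
  where
  gap : ∀ a p c q → a * (c + q) + (a + p) * c + p * q ≡ a * c + (a + p) * (c + q)
  gap = solve-∀

^-rearrange-≤ : ∀ n u v → u * v ^ n + v * u ^ n ≤ u * u ^ n + v * v ^ n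
^-rearrange-≤ n u v with ≤-total u v
... | inj₁ u≤v = *-rearrange-≤ u≤v (^-monoˡ-≤ n u≤v)
... | inj₂ v≤u = subst₂ _≤_ (+-comm (v * u ^ n) (u * v ^ n)) (+-comm (v * v ^ n) (u * u ^ n))
                        (*-rearrange-≤ v≤u (^-monoˡ-≤ n v≤u))

weighted-amgm : ∀ m u v → suc m * u * v ^ m ≤ u ^ suc m + m * v ^ suc m
weighted-amgm zero u v = ≤-reflexive (one u)
  where
  one : ∀ u → (1 * u) * 1 ≡ u * 1 + 0
  one = solve-∀
weighted-amgm (suc m) u v = +-cancelʳ-≤ (v * u ^ suc m) _ _ (begin
  suc (suc m) * u * v ^ suc m + v * u ^ suc m
    ≡⟨ expand m u v (u ^ m) (v ^ m) ⟩
  v * (suc m * u * v ^ m) + (u * v ^ suc m + v * u ^ suc m)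
    ≤⟨ +-mono-≤ (*-monoʳ-≤ v (weighted-amgm m u v)) (^-rearrange-≤ (suc m) u v) ⟩
  v * (u ^ suc m + m * v ^ suc m) + (u * u ^ suc m + v * v ^ suc m)
    ≡⟨ collect m u v (u ^ m) (v ^ m) ⟩
  u ^ suc (suc m) + suc m * v ^ suc (suc m) + v * u ^ suc m ∎)
  where
  open ≤-Reasoning
  expand : ∀ m u v U V → (2 + m) * u * (v * V) + v * (u * U)
                       ≡ v * ((1 + m) * u * V) + (u * (v * V) + v * (u * U))
  expand = solve-∀
  collect : ∀ m u v U V → v * (u * U + m * (v * V)) + (u * (u * U) + v * (v * V))
                        ≡ u * (u * U) + (1 + m) * (v * (v * V)) + v * (u * U)
  collect = solve-∀

-- AM-GM for y and n copies of s / n, cleared of denominators.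
amgm-step : ∀ n s y → suc n ^ suc n * (s ^ n * y) ≤ n ^ n * (y + s) ^ suc n
amgm-step zero s y = subst₂ _≤_ (lhs y) (rhs (y + s)) (m≤m+n y s)
  where
  lhs : ∀ y → y ≡ 1 * (1 * y)
  lhs = solve-∀
  rhs : ∀ x → x ≡ 1 * (x * 1)
  rhs = solve-∀
amgm-step n@(suc _) s y = *-cancelˡ-≤ n (+-cancelʳ-≤ (n * v ^ suc n) _ _ (begin
  n * (suc n ^ suc n * (s ^ n * y)) + n * v ^ suc n
    ≡⟨ cong (λ w → n * (suc n ^ suc n * (s ^ n * y)) + n * w) (^-distribʳ-* (suc n) s (suc n)) ⟩
  n * (suc n * A * (B * y)) + n * (suc n * A * (s * B))
    ≡⟨ factor n s y A B ⟩
  suc n * u * (A * B)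
    ≡⟨ cong (suc n * u *_) (^-distribʳ-* (suc n) s n) ⟨
  suc n * u * v ^ n
    ≤⟨ weighted-amgm n u v ⟩
  u ^ suc n + n * v ^ suc n
    ≡⟨ cong (_+ n * v ^ suc n) (^-distribʳ-* n (y + s) (suc n)) ⟩
  n * n ^ n * (y + s) ^ suc n + n * v ^ suc n
    ≡⟨ cong (_+ n * v ^ suc n) (*-assoc n (n ^ n) ((y + s) ^ suc n)) ⟩
  n * (n ^ n * (y + s) ^ suc n) + n * v ^ suc n ∎))
  where
  open ≤-Reasoning
  u v A B : ℕ
  u = n * (y + s)
  v = suc n * s
  A = suc n ^ n
  B = s ^ n
  factor : ∀ n s y A B → n * ((1 + n) * A * (B * y)) + n * ((1 + n) * A * (s * B))
                       ≡ (1 + n) * (n * (y + s)) * (A * B)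
  factor = solve-∀

amgm : ∀ xs → length xs ^ length xs * product xs ≤ sum xs ^ length xs
amgm [] = ≤-refl
amgm (y ∷ ys) = *-cancelˡ-≤ (n ^ n) {{n^n≢0 n}} (begin
  n ^ n * (suc n ^ suc n * (y * P))  ≡⟨ swap (n ^ n) (suc n ^ suc n) y P ⟩
  suc n ^ suc n * (y * (n ^ n * P))  ≤⟨ *-monoʳ-≤ (suc n ^ suc n) (*-monoʳ-≤ y (amgm ys)) ⟩
  suc n ^ suc n * (y * s ^ n)        ≡⟨ cong (suc n ^ suc n *_) (*-comm y (s ^ n)) ⟩
  suc n ^ suc n * (s ^ n * y)        ≤⟨ amgm-step n s y ⟩
  n ^ n * (y + s) ^ suc n            ∎)
  where
  open ≤-Reasoning
  n s P : ℕ
  n = length ys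
  s = sum ys
  P = product ys
  swap : ∀ a b y p → a * (b * (y * p)) ≡ b * (y * (a * p))
  swap = solve-∀
  n^n≢0 : ∀ n → NonZero (n ^ n)
  n^n≢0 zero = _
  n^n≢0 n@(suc _) = m^n≢0 n n

∑-const : ∀ n c → ∑[ i < n ] c ≡ n * c
∑-const zero c = refl
∑-const (suc n) c = cong (c +_) (∑-const n c)

∑-mono-≤ : ∀ {n} {f g : Fin n → ℕ} → (∀ i → f i ≤ g i) → ∑ f ≤ ∑ g
∑-mono-≤ {zero} f≤g = z≤n
∑-mono-≤ {suc n} f≤g = +-mono-≤ (f≤g zero) (∑-mono-≤ (f≤g ∘ suc))

∑-if : ∀ {n} b (f : Fin n → ℕ) → (if b then ∑ f else 0) ≡ ∑[ i < n ] (if b then f i else 0)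
∑-if true f = refl
∑-if {n} false f = sym (trans (∑-const n 0) (*-zeroʳ n))

∑-≤1 : ∀ {n} (f : Fin n → ℕ) → (∀ i → f i ≤ 1) → (∀ {i j} → 1 ≤ f i → 1 ≤ f j → i ≡ j) → ∑ f ≤ 1
∑-≤1 {zero} f f≤1 unique = z≤n
∑-≤1 {suc n} f f≤1 unique with n≤1⇒n≡0∨n≡1 (f≤1 zero)
... | inj₁ f0≡0 = subst (λ x → x + ∑ (f ∘ suc) ≤ 1) (sym f0≡0)
                        (∑-≤1 (f ∘ suc) (f≤1 ∘ suc) (λ p q → Finₚ.suc-injective (unique p q)))
... | inj₂ f0≡1 = ≤-reflexive (cong₂ _+_ f0≡1 (trans (sum-cong-≗ rest≡0) (sum-replicate-zero n)))
  where
  rest≡0 : ∀ j → f (suc j) ≡ 0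
  rest≡0 j with n≤1⇒n≡0∨n≡1 (f≤1 (suc j))
  ... | inj₁ fj≡0 = fj≡0
  ... | inj₂ fj≡1 = contradiction (unique (≤-reflexive (sym f0≡1)) (≤-reflexive (sym fj≡1))) Finₚ.0≢1+n

sum-tabulate : ∀ {n} (f : Fin n → ℕ) → sum (tabulate f) ≡ ∑ f
sum-tabulate {zero} f = refl
sum-tabulate {suc n} f = cong (f zero +_) (sum-tabulate (f ∘ suc))

sum-map-allFin : ∀ {n} (f : Fin n → ℕ) → sum (map f (allFin n)) ≡ ∑ f
sum-map-allFin f = trans (cong sum (map-tabulate (λ i → i) f)) (sum-tabulate f)

sum-map-cartesianProduct : ∀ {A B : Set} (f : A × B → ℕ) xs ys →
  sum (map f (cartesianProduct xs ys)) ≡ sum (map (λ x → sum (map (λ y → f (x , y)) ys)) xs)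
sum-map-cartesianProduct f [] ys = refl
sum-map-cartesianProduct f (x ∷ xs) ys = begin
  sum (map f (map (x ,_) ys ++ cartesianProduct xs ys))
    ≡⟨ cong sum (map-++ f (map (x ,_) ys) (cartesianProduct xs ys)) ⟩
  sum (map f (map (x ,_) ys) ++ map f (cartesianProduct xs ys))
    ≡⟨ sum-++ (map f (map (x ,_) ys)) (map f (cartesianProduct xs ys)) ⟩
  sum (map f (map (x ,_) ys)) + sum (map f (cartesianProduct xs ys))
    ≡⟨ cong₂ _+_ (cong sum (sym (map-∘ ys))) (sum-map-cartesianProduct f xs ys) ⟩
  sum (map (λ y → f (x , y)) ys) + sum (map (λ x → sum (map (λ y → f (x , y)) ys)) xs) ∎
  where open ≡-Reasoning

sum-map-filter : ∀ {A : Set} {P : A → Set} (P? : Decidable P) (f : A → ℕ) xs →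
  sum (map f (filter P? xs)) ≡ sum (map (λ x → if does (P? x) then f x else 0) xs)
sum-map-filter P? f [] = refl
sum-map-filter P? f (x ∷ xs) with does (P? x)
... | true = cong (f x +_) (sum-map-filter P? f xs)
... | false = sum-map-filter P? f xs

sum-map-1≡length : ∀ {A : Set} (xs : List A) → sum (map (λ _ → 1) xs) ≡ length xs
sum-map-1≡length [] = refl
sum-map-1≡length (x ∷ xs) = cong suc (sum-map-1≡length xs)

upperPart : ∀ {k} → (Fin k → Fin k → ℕ) → Fin k → Fin k → ℕ
upperPart f i j = if does (i <? j) then f i j else 0

upperPart-< : ∀ {k} (f : Fin k → Fin k → ℕ) {i j} → i < j → upperPart f i j ≡ f i j
upperPart-< f {i} {j} i<j = cong (if_then f i j else 0) (dec-true (i <? j) i<j)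

upperPart-≮ : ∀ {k} (f : Fin k → Fin k → ℕ) {i j} → ¬ i < j → upperPart f i j ≡ 0
upperPart-≮ f {i} {j} i≮j = cong (if_then f i j else 0) (dec-false (i <? j) i≮j)

sum-edgesK : ∀ k (f : Fin k → Fin k → ℕ) →
  sum (map (λ p → f (proj₁ p) (proj₂ p)) (edgesK k)) ≡ ∑[ i < k ] ∑[ j < k ] upperPart f i j
sum-edgesK k f = begin
  sum (map (λ p → f (proj₁ p) (proj₂ p)) (edgesK k))
    ≡⟨ sum-map-filter _ (λ p → f (proj₁ p) (proj₂ p)) (cartesianProduct (allFin k) (allFin k)) ⟩
  sum (map (λ p → upperPart f (proj₁ p) (proj₂ p)) (cartesianProduct (allFin k) (allFin k)))
    ≡⟨ sum-map-cartesianProduct (λ p → upperPart f (proj₁ p) (proj₂ p)) (allFin k) (allFin k) ⟩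
  sum (map (λ i → sum (map (upperPart f i) (allFin k))) (allFin k))
    ≡⟨ cong sum (map-cong (λ i → sum-map-allFin (upperPart f i)) (allFin k)) ⟩
  sum (map (λ i → ∑ (upperPart f i)) (allFin k))
    ≡⟨ sum-map-allFin (λ i → ∑ (upperPart f i)) ⟩
  ∑[ i < k ] ∑ (upperPart f i) ∎
  where open ≡-Reasoning

∑∑-upperPart-1≡C2 : ∀ k → ∑[ i < k ] ∑[ j < k ] upperPart (λ _ _ → 1) i j ≡ k C 2
∑∑-upperPart-1≡C2 zero = refl
∑∑-upperPart-1≡C2 (suc k) = begin
  ∑[ j < k ] 1 + ∑[ i < k ] ∑[ j < k ] upperPart (λ _ _ → 1) i j
    ≡⟨ cong₂ _+_ (trans (∑-const k 1) (*-identityʳ k)) (∑∑-upperPart-1≡C2 k) ⟩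
  k + k C 2
    ≡⟨ cong (_+ k C 2) (nC1≡n k) ⟨
  k C 1 + k C 2
    ≡⟨ nCk+nC[k+1]≡[n+1]C[k+1] k 1 ⟩
  suc k C 2 ∎
  where open ≡-Reasoning

length-edgesK : ∀ k → length (edgesK k) ≡ k C 2
length-edgesK k = begin
  length (edgesK k)                        ≡⟨ sum-map-1≡length (edgesK k) ⟨
  sum (map (λ _ → 1) (edgesK k))           ≡⟨ sum-edgesK k (λ _ _ → 1) ⟩
  ∑[ i < k ] ∑[ j < k ] upperPart (λ _ _ → 1) i j ≡⟨ ∑∑-upperPart-1≡C2 k ⟩
  k C 2 ∎
  where open ≡-Reasoning

∣p∣≡∑-indicator : ∀ {r} (p : Subset r) → ∣ p ∣ ≡ ∑[ x < r ] (if does (x ∈? p) then 1 else 0)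
∣p∣≡∑-indicator [] = refl
∣p∣≡∑-indicator (inside ∷ p) = cong suc (∣p∣≡∑-indicator p)
∣p∣≡∑-indicator (outside ∷ p) = ∣p∣≡∑-indicator p

∃-other-∈ : ∀ {r} (p : Subset r) → 2 ≤ ∣ p ∣ → (x : Fin r) → ∃[ y ] y ∈ p × y ≢ x
∃-other-∈ p 2≤∣p∣ x with Finₚ.any? (λ y → y ∈? p ×-dec ¬? (y ≟ x))
... | yes other = other
... | no none = contradiction (subst (∣ p ∣ ≤_) (∣⁅x⁆∣≡1 x) (p⊆q⇒∣p∣≤∣q∣ p⊆⁅x⁆)) (<⇒≱ 2≤∣p∣)
  where
  p⊆⁅x⁆ : p ⊆ ⁅ x ⁆
  p⊆⁅x⁆ {y} y∈p = subst (_∈ ⁅ x ⁆) (sym (decidable-stable (y ≟ x) (λ y≢x → none (y , y∈p , y≢x)))) (x∈⁅x⁆ x)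

module ColourClass {k r} (L : ColoredKk k r) (c : Fin r) where

  hasColour : Fin k → Fin k → ℕ
  hasColour i j = if does (c ∈? L i j) then 1 else 0

  colourCount : ℕ
  colourCount = ∑[ i < k ] ∑[ j < k ] upperPart hasColour i j

  Joined : Fin k → Fin k → Set
  Joined i j = (i < j × c ∈ L i j) ⊎ (j < i × c ∈ L j i)

  incidence : Fin k → Fin k → ℕ
  incidence i j = upperPart hasColour i j + upperPart hasColour j i

  hasColour≤1 : ∀ i j → hasColour i j ≤ 1
  hasColour≤1 i j with c ∈? L i j
  ... | yes _ = ≤-refl
  ... | no _ = z≤n

  1≤hasColour⇒c∈ : ∀ {i j} → 1 ≤ hasColour i j → c ∈ L i j
  1≤hasColour⇒c∈ {i} {j} 1≤ with c ∈? L i j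
  ... | yes c∈ij = c∈ij
  1≤hasColour⇒c∈ () | no _

  incidence-cases : ∀ i j → (i < j × incidence i j ≡ hasColour i j)
                          ⊎ (j < i × incidence i j ≡ hasColour j i)
                          ⊎ incidence i j ≡ 0
  incidence-cases i j with Finₚ.<-cmp i j
  ... | tri< i<j _ j≮i = inj₁ (i<j , trans (cong₂ _+_ (upperPart-< hasColour i<j) (upperPart-≮ hasColour j≮i))
                                           (+-identityʳ (hasColour i j)))
  ... | tri≈ i≮j _ j≮i = inj₂ (inj₂ (cong₂ _+_ (upperPart-≮ hasColour i≮j) (upperPart-≮ hasColour j≮i)))
  ... | tri> i≮j _ j<i = inj₂ (inj₁ (j<i , cong₂ _+_ (upperPart-≮ hasColour i≮j) (upperPart-< hasColour j<i)))

  incidence≤1 : ∀ i j → incidence i j ≤ 1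
  incidence≤1 i j with incidence-cases i j
  ... | inj₁ (_ , e) = subst (_≤ 1) (sym e) (hasColour≤1 i j)
  ... | inj₂ (inj₁ (_ , e)) = subst (_≤ 1) (sym e) (hasColour≤1 j i)
  ... | inj₂ (inj₂ e) = subst (_≤ 1) (sym e) z≤n

  incidence⇒Joined : ∀ {i j} → 1 ≤ incidence i j → Joined i j
  incidence⇒Joined {i} {j} 1≤ with incidence-cases i j
  ... | inj₁ (i<j , e) = inj₁ (i<j , 1≤hasColour⇒c∈ (subst (1 ≤_) e 1≤))
  ... | inj₂ (inj₁ (j<i , e)) = inj₂ (j<i , 1≤hasColour⇒c∈ (subst (1 ≤_) e 1≤))
  ... | inj₂ (inj₂ e) = contradiction (subst (1 ≤_) e 1≤) λ ()

  double-count : colourCount + colourCount ≡ ∑[ i < k ] ∑ (incidence i)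
  double-count = begin
    colourCount + colourCount
      ≡⟨ cong (colourCount +_) (∑-comm (upperPart hasColour)) ⟩
    colourCount + ∑[ i < k ] ∑[ j < k ] upperPart hasColour j i
      ≡⟨ ∑-distrib-+ (λ i → ∑ (upperPart hasColour i)) (λ i → ∑[ j < k ] upperPart hasColour j i) ⟨
    ∑[ i < k ] (∑ (upperPart hasColour i) + ∑[ j < k ] upperPart hasColour j i)
      ≡⟨ sum-cong-≗ (λ i → ∑-distrib-+ (upperPart hasColour i) (λ j → upperPart hasColour j i)) ⟨
    ∑[ i < k ] ∑ (incidence i) ∎
    where open ≡-Reasoning

  module _ (large : (i j : Fin k) → i < j → 2 ≤ ∣ L i j ∣) (free : K32Free L) where

    ¬c∈ij×c∈jl : ∀ {i j l} → i < j → j < l → c ∈ L i j → c ∈ L j l → ⊥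
    ¬c∈ij×c∈jl {i} {j} {l} i<j j<l c∈ij c∈jl with ∃-other-∈ (L i l) (large i l (Finₚ.<-trans i<j j<l)) c
    ... | d , d∈il , d≢c = free i j l i<j j<l c c d c∈ij c∈jl d∈il (inj₁ (refl , d≢c ∘ sym))

    ¬c∈jl×c∈il : ∀ {i j l} → i < j → j < l → c ∈ L j l → c ∈ L i l → ⊥
    ¬c∈jl×c∈il {i} {j} {l} i<j j<l c∈jl c∈il with ∃-other-∈ (L i j) (large i j i<j) c
    ... | d , d∈ij , d≢c = free i j l i<j j<l d c c d∈ij c∈jl c∈il (inj₂ (inj₁ (refl , d≢c ∘ sym)))

    ¬c∈ij×c∈il : ∀ {i j l} → i < j → j < l → c ∈ L i j → c ∈ L i l → ⊥
    ¬c∈ij×c∈il {i} {j} {l} i<j j<l c∈ij c∈il with ∃-other-∈ (L j l) (large j l j<l) c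
    ... | d , d∈jl , d≢c = free i j l i<j j<l c d c c∈ij d∈jl c∈il (inj₂ (inj₂ (refl , d≢c ∘ sym)))

    ¬Joined-fork : ∀ {i j j′} → j < j′ → Joined i j → Joined i j′ → ⊥
    ¬Joined-fork j<j′ (inj₁ (i<j , c∈ij)) (inj₁ (i<j′ , c∈ij′)) = ¬c∈ij×c∈il i<j j<j′ c∈ij c∈ij′
    ¬Joined-fork j<j′ (inj₁ (i<j , _)) (inj₂ (j′<i , _)) = Finₚ.<-asym j<j′ (Finₚ.<-trans j′<i i<j)
    ¬Joined-fork j<j′ (inj₂ (j<i , c∈ji)) (inj₁ (i<j′ , c∈ij′)) = ¬c∈ij×c∈jl j<i i<j′ c∈ji c∈ij′
    ¬Joined-fork j<j′ (inj₂ (j<i , c∈ji)) (inj₂ (j′<i , c∈j′i)) = ¬c∈jl×c∈il j<j′ j′<i c∈j′i c∈ji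

    Joined-unique : ∀ {i j j′} → Joined i j → Joined i j′ → j ≡ j′
    Joined-unique {j = j} {j′} ij ij′ with Finₚ.<-cmp j j′
    ... | tri< j<j′ _ _ = contradiction ij′ (¬Joined-fork j<j′ ij)
    ... | tri≈ _ j≡j′ _ = j≡j′
    ... | tri> _ _ j′<j = contradiction ij (¬Joined-fork j′<j ij′)

    colourCount≤k/2 : colourCount ≤ k / 2
    colourCount≤k/2 = subst (_≤ k / 2) (m*n/n≡m colourCount 2) (/-monoˡ-≤ 2 (begin
      colourCount * 2                 ≡⟨ *-comm colourCount 2 ⟩
      colourCount + (colourCount + 0) ≡⟨ cong (colourCount +_) (+-identityʳ colourCount) ⟩
      colourCount + colourCount       ≡⟨ double-count ⟩
      ∑[ i < k ] ∑ (incidence i)      ≤⟨ ∑-mono-≤ degree≤1 ⟩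
      ∑[ i < k ] 1                    ≡⟨ ∑-const k 1 ⟩
      k * 1                           ≡⟨ *-identityʳ k ⟩
      k                               ∎))
      where
      open ≤-Reasoning
      degree≤1 : ∀ i → ∑ (incidence i) ≤ 1
      degree≤1 i = ∑-≤1 (incidence i) (incidence≤1 i)
                        (λ p q → Joined-unique (incidence⇒Joined p) (incidence⇒Joined q))

sum-sizes≤r*[k/2] : ∀ {k r} (L : ColoredKk k r) → ((i j : Fin k) → i < j → 2 ≤ ∣ L i j ∣) → K32Free L →
  sum (map (λ p → ∣ L (proj₁ p) (proj₂ p) ∣) (edgesK k)) ≤ r * (k / 2)
sum-sizes≤r*[k/2] {k} {r} L large free = begin
  sum (map (λ p → ∣ L (proj₁ p) (proj₂ p) ∣) (edgesK k))
    ≡⟨ sum-edgesK k (λ i j → ∣ L i j ∣) ⟩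
  ∑[ i < k ] ∑[ j < k ] upperPart (λ i j → ∣ L i j ∣) i j
    ≡⟨ sum-cong-≗ (λ i → sum-cong-≗ (λ j → split-by-colour i j)) ⟩
  ∑[ i < k ] ∑[ j < k ] ∑[ c < r ] upperPart (hasColour c) i j
    ≡⟨ sum-cong-≗ (λ i → ∑-comm (λ j c → upperPart (hasColour c) i j)) ⟩
  ∑[ i < k ] ∑[ c < r ] ∑[ j < k ] upperPart (hasColour c) i j
    ≡⟨ ∑-comm (λ i c → ∑[ j < k ] upperPart (hasColour c) i j) ⟩
  ∑[ c < r ] colourCount c
    ≤⟨ ∑-mono-≤ (λ c → colourCount≤k/2 c large free) ⟩
  ∑[ c < r ] (k / 2)
    ≡⟨ ∑-const r (k / 2) ⟩
  r * (k / 2) ∎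
  where
  open ≤-Reasoning
  open ColourClass L
  split-by-colour : ∀ i j → upperPart (λ i j → ∣ L i j ∣) i j ≡ ∑[ c < r ] upperPart (hasColour c) i j
  split-by-colour i j = trans (cong (if does (i <? j) then_else 0) (∣p∣≡∑-indicator (L i j)))
                             (∑-if (does (i <? j)) (λ c → hasColour c i j))

lemma3p7 : (r k : ℕ) → 2 ≤ r → 3 ≤ k → (L : ColoredKk k r) →
    ((i j : Fin k) → i < j → 2 ≤ ∣ L i j ∣) → K32Free L →
    edgeProduct L * (k C 2) ^ (k C 2) ≤ (r * (k / 2)) ^ (k C 2)
lemma3p7 r k _ _ L large free =
  subst (λ n → edgeProduct L * n ^ n ≤ (r * (k / 2)) ^ n) length-sizes (begin
    product sizes * n ^ n  ≡⟨ *-comm (product sizes) (n ^ n) ⟩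
    n ^ n * product sizes  ≤⟨ amgm sizes ⟩
    sum sizes ^ n          ≤⟨ ^-monoˡ-≤ n (sum-sizes≤r*[k/2] L large free) ⟩
    (r * (k / 2)) ^ n      ∎)
  where
  open ≤-Reasoning
  sizes : List ℕ
  sizes = map (λ p → ∣ L (proj₁ p) (proj₂ p) ∣) (edgesK k)
  n : ℕ
  n = length sizes
  length-sizes : n ≡ k C 2
  length-sizes = trans (length-map _ (edgesK k)) (length-edgesK k)
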